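{- For integers $3\leq x\leq y$, $\gamma_{P,c}(K_{1,x}\,\square\,K_{1,y})=x$.
   Context: Power domination: for $S\subseteq V(G)$, start with $M(S)=N[S]$ and repeatedly add a vertex $w$ whenever some $v\in M(S)$ has $w$ as its unique neighbour outside $M(S)$; $S$ is a connected power dominating set if the final $M(S)$ is $V(G)$ and $\langle S\rangle$ is connected; $\gamma_{P,c}(G)$ is the minimum size of such a set. The Cartesian product $G\,\square\,H$ has vertex set $V(G)\times V(H)$, with $(a,b)\sim(x,y)$ iff either $a=x$ and $by\in E(H)$, or $b=y$ and $ax\in E(G)$. $K_{1,x}$ is the star with $x$ leaves. -}

module Defs where

open import Level using (0ℓ)
open import Data.Nat using (ℕ; suc)
open import Data.Fin using (Fin; zero)
open import Data.Product using (_×_; _,_; ∃-syntax)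
open import Data.Sum using (_⊎_)
open import Data.List using (List; length)
open import Data.List.Membership.Propositional using (_∈_)
open import Data.List.Relation.Unary.Unique.Propositional using (Unique)
open import Relation.Binary.PropositionalEquality using (_≡_; _≢_)

record Graph : Set₁ where
  field
    V   : Set
    _~_ : V → V → Set
open Graph public

Star : ℕ → Graph
Star x = record
  { V   = Fin (suc x)
  ; _~_ = λ u v → (u ≡ zero × v ≢ zero) ⊎ (v ≡ zero × u ≢ zero)
  }

_□_ : Graph → Graph → Graph
G □ H = record
  { V   = V G × V H
  ; _~_ = λ { (a , b) (x , y) → (a ≡ x × _~_ H b y) ⊎ (b ≡ y × _~_ G a x) }
  }

module _ (G : Graph) where
  private
    W = V G
    _∼_ = _~_ G

  -- Final monitored set M(S) of the power domination process, as the least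
  -- set closed under the domination step (N[S]) and the propagation rule.
  data Monitored (S : List W) : W → Set where
    self  : ∀ {v} → v ∈ S → Monitored S v
    nbr   : ∀ {u v} → u ∈ S → u ∼ v → Monitored S v
    force : ∀ {u w} → Monitored S u → u ∼ w →
            (∀ w′ → u ∼ w′ → w′ ≢ w → Monitored S w′) →
            Monitored S w

  data ReachIn (S : List W) : W → W → Set where
    here : ∀ {u} → u ∈ S → ReachIn S u u
    step : ∀ {u v w} → ReachIn S u v → v ∼ w → w ∈ S → ReachIn S u w

  InducedConnected : List W → Set
  InducedConnected S = ∀ {u v} → u ∈ S → v ∈ S → ReachIn S u v

  IsCPDS : List W → Set
  IsCPDS S = Unique S × (∀ v → Monitored S v) × InducedConnected S

  ConnPowerDomNumber : ℕ → Set
  ConnPowerDomNumber k =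
    (∃[ S ] (IsCPDS S × length S ≡ k)) × (∀ S → IsCPDS S → k Data.Nat.≤ length S)

{-# OPTIONS --safe #-}
module Submission where

-- Upper bound: the centre column of K_{1,y} with one leaf row of K_{1,x} removed is connected, dominates
-- every row but the removed one, and each vertex of that row is then forced from the centre row.
-- Lower bound: every edge joining two different rows passes through the centre row, so a connected S
-- either meets the centre row or lies in a single row; the same holds for columns.  Hence if |S| < x ≤ y,
-- two leaf rows i, i′ and two leaf columns j, j′ avoid S entirely, and {i, i′} × {j, j′} is a fort
-- disjoint from N[S]; no vertex of a fort is ever monitored.

open import Level using (0ℓ)
open import Data.Nat using (ℕ; suc; _≤_; _<_; z≤n; s≤s)
open import Data.Nat.Properties using (≤-trans; <⇒≤; ≮⇒≥)
open import Data.Fin using (Fin; zero; suc; punchIn; punchOut; fromℕ<; _≟_)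
open import Data.Fin.Properties using (pigeonhole; ¬∀⟶∃¬; <⇒≢; punchIn-injective; punchIn-punchOut)
open import Data.Product using (_×_; _,_; proj₁; proj₂; ∃; ∃₂; Σ)
open import Data.Sum using (_⊎_; inj₁; inj₂)
open import Data.Empty using (⊥; ⊥-elim)
open import Data.List using (List; []; _∷_; length; map; tabulate; lookup)
open import Data.List.Properties using (length-map; length-tabulate)
open import Data.List.Relation.Unary.Any as Any using (Any; here; there; any?; index)
open import Data.List.Relation.Unary.Any.Properties using (lookup-index; map⁺)
open import Data.List.Membership.Propositional using (_∈_; _∉_; lose)
open import Data.List.Membership.Propositional.Properties using (∈-map⁺; ∈-tabulate⁺; ∈-tabulate⁻)
open import Data.List.Relation.Unary.Unique.Propositional.Properties using (tabulate⁺)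
open import Relation.Binary.PropositionalEquality
  using (_≡_; _≢_; refl; sym; trans; cong; subst; module ≡-Reasoning)
open import Relation.Nullary using (¬_; yes; no)
open import Relation.Unary using (Pred; Decidable; ｛_｝; _∪_; _⟨×⟩_)

open import Defs

short⇒∃∉ : ∀ {n} (L : List (Fin n)) → length L < n → ∃ λ i → i ∉ L
short⇒∃∉ {n} L |L|<n = ¬∀⟶∃¬ n (_∈ L) (λ i → any? (i ≟_) L) not-all-in
  where
  not-all-in : ¬ (∀ i → i ∈ L)
  not-all-in i∈L with pigeonhole |L|<n (λ i → index (i∈L i))
  ... | i , j , i<j , same-index = <⇒≢ i<j (begin
    i                        ≡⟨ lookup-index (i∈L i) ⟩
    lookup L (index (i∈L i)) ≡⟨ cong (lookup L) same-index ⟩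
    lookup L (index (i∈L j)) ≡⟨ sym (lookup-index (i∈L j)) ⟩
    j                        ∎)
    where open ≡-Reasoning

short⇒∃₂∉ : ∀ {n} (L : List (Fin n)) → suc (length L) < n → ∃₂ λ i i′ → i ≢ i′ × i ∉ L × i′ ∉ L
short⇒∃₂∉ L |L|+1<n with short⇒∃∉ L (<⇒≤ |L|+1<n)
... | i , i∉L with short⇒∃∉ (i ∷ L) |L|+1<n
... | i′ , i′∉i∷L = i , i′ , (λ i≡i′ → i′∉i∷L (here (sym i≡i′))) , i∉L , (λ i′∈L → i′∉i∷L (there i′∈L))

module _ {G : Graph} where
  open Graph G using () renaming (V to W; _~_ to _∼_)

  -- The usual "no vertex outside F has exactly one neighbour in F", stated positively.
  IsFort : Pred W 0ℓ → Set
  IsFort F = ∀ {u w} → ¬ F u → u ∼ w → F w → ∃ λ w′ → u ∼ w′ × w′ ≢ w × F w′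

  fort-unmonitored : ∀ {F S} → IsFort F →
    (∀ {s} → s ∈ S → ¬ F s) → (∀ {s v} → s ∈ S → s ∼ v → ¬ F v) →
    ∀ {v} → Monitored G S v → ¬ F v
  fort-unmonitored {F} {S} fort S∩F=∅ N[S]∩F=∅ = unmonitored
    where
    unmonitored : ∀ {v} → Monitored G S v → ¬ F v
    unmonitored (self s∈S) = S∩F=∅ s∈S
    unmonitored (nbr s∈S s∼v) = N[S]∩F=∅ s∈S s∼v
    unmonitored (force u-mon u∼w others) Fw with fort (unmonitored u-mon) u∼w Fw
    ... | w′ , u∼w′ , w′≢w , Fw′ = unmonitored (others w′ u∼w′ w′≢w) Fw′

  ReachIn-end : ∀ {S u v} → ReachIn G S u v → v ∈ S
  ReachIn-end (here v∈S) = v∈S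
  ReachIn-end (step _ _ v∈S) = v∈S

  ReachIn-trans : ∀ {S u v w} → ReachIn G S u v → ReachIn G S v w → ReachIn G S u w
  ReachIn-trans p (here _) = p
  ReachIn-trans p (step q v∼w w∈S) = step (ReachIn-trans p q) v∼w w∈S

  module _ {A : Set} (f : W → A) {C : Pred W 0ℓ}
           (f-stable : ∀ {u v} → u ∼ v → ¬ C u → ¬ C v → f u ≡ f v) where

    ReachIn-avoiding-preserves : ∀ {S u v} → (∀ {s} → s ∈ S → ¬ C s) → ReachIn G S u v → f u ≡ f v
    ReachIn-avoiding-preserves S∩C=∅ (here _) = refl
    ReachIn-avoiding-preserves S∩C=∅ (step p v∼w w∈S) =
      trans (ReachIn-avoiding-preserves S∩C=∅ p) (f-stable v∼w (S∩C=∅ (ReachIn-end p)) (S∩C=∅ w∈S))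

    connected⇒meets-or-constant : Decidable C → ∀ {S} → InducedConnected G S →
      Any C S ⊎ (∀ {u v} → u ∈ S → v ∈ S → f u ≡ f v)
    connected⇒meets-or-constant C? {S} connected with any? C? S
    ... | yes meets = inj₁ meets
    ... | no misses = inj₂ λ u∈S v∈S →
      ReachIn-avoiding-preserves (λ s∈S Cs → misses (lose s∈S Cs)) (connected u∈S v∈S)

module _ {G H : Graph} where

  □-step-proj₁ : ∀ {u v} → _~_ (G □ H) u v → proj₁ u ≡ proj₁ v ⊎ _~_ G (proj₁ u) (proj₁ v)
  □-step-proj₁ {_ , _} {_ , _} (inj₁ (a≡x , _)) = inj₁ a≡x
  □-step-proj₁ {_ , _} {_ , _} (inj₂ (_ , a∼x)) = inj₂ a∼x

  □-step-proj₂ : ∀ {u v} → _~_ (G □ H) u v → proj₂ u ≡ proj₂ v ⊎ _~_ H (proj₂ u) (proj₂ v)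
  □-step-proj₂ {_ , _} {_ , _} (inj₁ (_ , b∼y)) = inj₂ b∼y
  □-step-proj₂ {_ , _} {_ , _} (inj₂ (b≡y , _)) = inj₁ b≡y

  ⟨×⟩-isFort : ∀ {A B} → IsFort {G} A → IsFort {H} B → IsFort {G □ H} (A ⟨×⟩ B)
  ⟨×⟩-isFort fortA fortB {_ , d} {a , _} ¬Fu (inj₁ (refl , d∼b)) (Aa , Bb)
    with fortB (λ Bd → ¬Fu (Aa , Bd)) d∼b Bb
  ... | b′ , d∼b′ , b′≢b , Bb′ = (a , b′) , inj₁ (refl , d∼b′) , (λ e → b′≢b (cong proj₂ e)) , Aa , Bb′
  ⟨×⟩-isFort fortA fortB {c , _} {_ , b} ¬Fu (inj₂ (refl , c∼a)) (Aa , Bb)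
    with fortA (λ Ac → ¬Fu (Ac , Bb)) c∼a Aa
  ... | a′ , c∼a′ , a′≢a , Aa′ = (a′ , b) , inj₂ (refl , c∼a′) , (λ e → a′≢a (cong proj₁ e)) , Aa′ , Bb

  □-neighbour-∉-⟨×⟩ : ∀ {A : Pred (V G) 0ℓ} {B : Pred (V H) 0ℓ} {s v} →
    ¬ A (proj₁ s) → ¬ B (proj₂ s) → _~_ (G □ H) s v → ¬ (A ⟨×⟩ B) v
  □-neighbour-∉-⟨×⟩ {s = _ , _} ¬As _ (inj₁ (refl , _)) (Av , _) = ¬As Av
  □-neighbour-∉-⟨×⟩ {s = _ , _} _ ¬Bs (inj₂ (refl , _)) (_ , Bv) = ¬Bs Bv

Star-leaf-step : ∀ {n} {a b : Fin (suc n)} → a ≡ b ⊎ _~_ (Star n) a b → a ≢ zero → b ≢ zero → a ≡ b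
Star-leaf-step (inj₁ a≡b) _ _ = a≡b
Star-leaf-step (inj₂ (inj₁ (a≡0 , _))) a≢0 _ = ⊥-elim (a≢0 a≡0)
Star-leaf-step (inj₂ (inj₂ (b≡0 , _))) _ b≢0 = ⊥-elim (b≢0 b≡0)

Star-centre-dominates : ∀ {n} (b : Fin (suc n)) → b ≡ zero ⊎ _~_ (Star n) zero b
Star-centre-dominates zero = inj₁ refl
Star-centre-dominates (suc _) = inj₂ (inj₁ (refl , λ ()))

record LeafPair (n : ℕ) : Set where
  field
    leaf₁ leaf₂ : Fin (suc n)
    leaf₁≢0 : leaf₁ ≢ zero
    leaf₂≢0 : leaf₂ ≢ zero
    leaf₁≢leaf₂ : leaf₁ ≢ leaf₂

  set : Pred (Fin (suc n)) 0ℓ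
  set = ｛ leaf₁ ｝ ∪ ｛ leaf₂ ｝

  isFort : IsFort {Star n} set
  isFort _ (inj₂ (refl , _)) (inj₁ leaf₁≡0) = ⊥-elim (leaf₁≢0 leaf₁≡0)
  isFort _ (inj₂ (refl , _)) (inj₂ leaf₂≡0) = ⊥-elim (leaf₂≢0 leaf₂≡0)
  isFort _ (inj₁ (refl , _)) (inj₁ refl) =
    leaf₂ , inj₁ (refl , leaf₂≢0) , (λ e → leaf₁≢leaf₂ (sym e)) , inj₂ refl
  isFort _ (inj₁ (refl , _)) (inj₂ refl) =
    leaf₁ , inj₁ (refl , leaf₁≢0) , leaf₁≢leaf₂ , inj₁ refl

open LeafPair using (leaf₁; set; isFort)

module _ {n : ℕ} {W : Set} (f : W → Fin (suc n)) (3≤n : 3 ≤ n) where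

  private
    covering-values : ∀ S → length S < n →
      Any (λ s → f s ≡ zero) S ⊎ (∀ {u v} → u ∈ S → v ∈ S → f u ≡ f v) →
      ∃ λ L → zero ∈ L × length L < n × (∀ {s} → s ∈ S → f s ∈ L)
    covering-values S |S|<n (inj₁ meets) =
      map f S , map⁺ (Any.map sym meets) , subst (_< n) (sym (length-map f S)) |S|<n , ∈-map⁺ f
    covering-values [] _ (inj₂ _) =
      zero ∷ [] , here refl , ≤-trans (s≤s (s≤s z≤n)) 3≤n , λ ()
    covering-values (s ∷ _) _ (inj₂ constant) =
      zero ∷ f s ∷ [] , here refl , 3≤n , λ t∈S → there (here (constant t∈S (here refl)))

  avoided-leaf-pair : ∀ S → length S < n →
    Any (λ s → f s ≡ zero) S ⊎ (∀ {u v} → u ∈ S → v ∈ S → f u ≡ f v) →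
    Σ (LeafPair n) λ P → ∀ {s} → s ∈ S → ¬ set P (f s)
  avoided-leaf-pair S |S|<n meets-or-constant with covering-values S |S|<n meets-or-constant
  ... | L , 0∈L , |L|<n , covered with short⇒∃₂∉ L (s≤s |L|<n)
  ... | i , i′ , i≢i′ , i∉L , i′∉L = pair , avoids
    where
    pair : LeafPair n
    pair = record
      { leaf₁ = i ; leaf₂ = i′ ; leaf₁≢leaf₂ = i≢i′
      ; leaf₁≢0 = λ i≡0 → i∉L (subst (_∈ L) (sym i≡0) 0∈L)
      ; leaf₂≢0 = λ i′≡0 → i′∉L (subst (_∈ L) (sym i′≡0) 0∈L)
      }

    avoids : ∀ {s} → s ∈ S → ¬ set pair (f s)
    avoids s∈S (inj₁ i≡fs) = i∉L (subst (_∈ L) (sym i≡fs) (covered s∈S))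
    avoids s∈S (inj₂ i′≡fs) = i′∉L (subst (_∈ L) (sym i′≡fs) (covered s∈S))

Star□Star-lower-bound : ∀ {x y} → 3 ≤ x → x ≤ y → ∀ S → IsCPDS (Star x □ Star y) S → x ≤ length S
Star□Star-lower-bound {x} {y} 3≤x x≤y S (_ , monitored , connected) = ≮⇒≥ not-short
  where
  rows : Any (λ s → proj₁ s ≡ zero) S ⊎ (∀ {u v} → u ∈ S → v ∈ S → proj₁ u ≡ proj₁ v)
  rows = connected⇒meets-or-constant proj₁ (λ e → Star-leaf-step (□-step-proj₁ {Star x} {Star y} e))
           (λ s → proj₁ s ≟ zero) connected

  columns : Any (λ s → proj₂ s ≡ zero) S ⊎ (∀ {u v} → u ∈ S → v ∈ S → proj₂ u ≡ proj₂ v)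
  columns = connected⇒meets-or-constant proj₂ (λ e → Star-leaf-step (□-step-proj₂ {Star x} {Star y} e))
              (λ s → proj₂ s ≟ zero) connected

  avoided-fort-monitored : Σ (LeafPair x) (λ P → ∀ {s} → s ∈ S → ¬ set P (proj₁ s)) →
                           Σ (LeafPair y) (λ Q → ∀ {s} → s ∈ S → ¬ set Q (proj₂ s)) → ⊥
  avoided-fort-monitored (P , S-avoids-P) (Q , S-avoids-Q) =
    fort-unmonitored {Star x □ Star y} (⟨×⟩-isFort {Star x} {Star y} (isFort P) (isFort Q))
      (λ s∈S (Ps , _) → S-avoids-P s∈S Ps)
      (λ s∈S → □-neighbour-∉-⟨×⟩ {Star x} {Star y} (S-avoids-P s∈S) (S-avoids-Q s∈S))
      (monitored (leaf₁ P , leaf₁ Q)) (inj₁ refl , inj₁ refl)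

  not-short : ¬ (length S < x)
  not-short |S|<x = avoided-fort-monitored
    (avoided-leaf-pair proj₁ 3≤x S |S|<x rows)
    (avoided-leaf-pair proj₂ (≤-trans 3≤x x≤y) S (≤-trans |S|<x x≤y) columns)

module _ {n : ℕ} (H : Graph) (c : V H) (c-dominates : ∀ b → b ≡ c ⊎ _~_ H c b) (ℓ : Fin n) where

  dominating-column-minus-leaf : List (Fin (suc n) × V H)
  dominating-column-minus-leaf = tabulate (λ k → punchIn (suc ℓ) k , c)

  private
    S₀ = dominating-column-minus-leaf
    G = Star n □ H

    ∈S₀ : ∀ {a} → suc ℓ ≢ a → (a , c) ∈ S₀
    ∈S₀ ℓ≢a = subst (λ a → (a , c) ∈ S₀) (punchIn-punchOut ℓ≢a) (∈-tabulate⁺ (punchOut ℓ≢a))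

    hub∈S₀ : (zero , c) ∈ S₀
    hub∈S₀ = ∈S₀ λ ()

    monitored-off-row : ∀ {a} → suc ℓ ≢ a → ∀ b → Monitored G S₀ (a , b)
    monitored-off-row ℓ≢a b with c-dominates b
    ... | inj₁ refl = self (∈S₀ ℓ≢a)
    ... | inj₂ c∼b = nbr (∈S₀ ℓ≢a) (inj₁ (refl , c∼b))

    monitored : ∀ v → Monitored G S₀ v
    monitored (a , b) with suc ℓ ≟ a
    ... | no ℓ≢a = monitored-off-row ℓ≢a b
    ... | yes refl = force (monitored-off-row (λ ()) b) (inj₂ (refl , inj₁ (refl , λ ()))) others
      where
      others : ∀ w → _~_ G (zero , b) w → w ≢ (suc ℓ , b) → Monitored G S₀ w
      others (_ , d) (inj₁ (refl , _)) _ = monitored-off-row (λ ()) d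
      others (a′ , _) (inj₂ (refl , _)) w≢ = monitored-off-row (λ ℓ≡a′ → w≢ (cong (_, b) (sym ℓ≡a′))) b

    spoke : ∀ {s} → s ∈ S₀ → ReachIn G S₀ s (zero , c) × ReachIn G S₀ (zero , c) s
    spoke s∈S₀ with ∈-tabulate⁻ s∈S₀
    ... | k , refl with punchIn (suc ℓ) k ≟ zero
    ...   | yes a≡0 rewrite a≡0 = here hub∈S₀ , here hub∈S₀
    ...   | no a≢0 = step (here s∈S₀) (inj₂ (refl , inj₂ (refl , a≢0))) hub∈S₀
                   , step (here hub∈S₀) (inj₂ (refl , inj₁ (refl , a≢0))) s∈S₀

  dominating-column-minus-leaf-isCPDS : IsCPDS (Star n □ H) dominating-column-minus-leaf
  dominating-column-minus-leaf-isCPDS =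
    tabulate⁺ (λ e → punchIn-injective (suc ℓ) _ _ (cong proj₁ e)) ,
    monitored ,
    λ s∈S₀ t∈S₀ → ReachIn-trans (proj₁ (spoke s∈S₀)) (proj₂ (spoke t∈S₀))

theorem8 : (x y : ℕ) → 3 ≤ x → x ≤ y →
    ConnPowerDomNumber (Star x □ Star y) x
theorem8 x y 3≤x x≤y =
  (dominating-column-minus-leaf (Star y) zero Star-centre-dominates leaf ,
   dominating-column-minus-leaf-isCPDS (Star y) zero Star-centre-dominates leaf ,
   length-tabulate _) ,
  Star□Star-lower-bound 3≤x x≤y
  where
  leaf : Fin x
  leaf = fromℕ< 3≤x
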